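{- Suppose that $\sigma(P)$ is (standalone) categorical in $S$ as an $\mathcal{L}_{\sigma}$-scheme. Let $Q$ be any fresh predicate not in $\mathcal{L}_{\sigma}\cup\{P\}$. Then $\sigma(P)\wedge \alpha[Q/P]\wedge\mu_Q(\alpha)(P)$ is (standalone) categorical in $S$ as an $\mathcal{L}_\sigma\cup \{Q\}$ scheme.
   Context: $\alpha$ is a formula of $\mathcal{L}_\sigma$ with the marked predicate $P$; $\alpha[Q/P]$ is the result of substituting $Q$ for $P$, and $\mu_Q(\alpha)(P)$ denotes the scheme $\alpha\rightarrow\forall x(Q(x)\rightarrow P(x))$ (i.e. $Q$ is contained in every set having property $\alpha$). For a collection of schemes $S$, $\mathrm{PC}(S)$ is the theory whose models are pairs $(\mathcal{M},\mathcal{X})$, with $\mathcal{X}$ a family of subsets (of powers) of $M$ containing every set definable by a first-order formula with first-order parameters from $M$ and second-order parameters from $\mathcal{X}$, and satisfying all instances of the schemes in $S$ with $P$ replaced by members of $\mathcal{X}$; $\mathrm{sPC}(S)$ is the same with comprehension only for formulas without first-order parameters. An $\mathcal{X}$-strong model of a scheme is a structure with domain, equality and relations in $\mathcal{X}$ satisfying every instance of the scheme with $P$ replaced by any member of $\mathcal{X}$. A scheme is categorical (resp. standalone categorical) in $S$ if for every $(\mathcal{M},\mathcal{X})\models\mathrm{PC}(S)$ (resp. $\mathrm{sPC}(S)$) any two $\mathcal{X}$-strong models of it are isomorphic via an isomorphism in $\mathcal{X}$. -}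

module Defs where

open import Data.Nat using (ℕ; _+_; _*_)
open import Data.Fin using (Fin; zero)
open import Data.Vec using (Vec; []; _∷_; lookup; _++_; concat; head)
open import Data.Vec.Relation.Binary.Pointwise.Inductive using (Pointwise)
open import Data.Vec.Relation.Unary.All using (All)
open import Data.Sum using (_⊎_; inj₁; inj₂; [_,_])
open import Data.Product using (Σ; _×_; _,_; proj₁)
open import Data.Unit using (⊤; tt)
open import Data.Empty using (⊥)
open import Data.Bool using (Bool; true; false)
open import Relation.Binary.PropositionalEquality using (_≡_; subst; sym; refl)
open import Function.Bundles using (_⇔_)

record Language : Set₁ where
  field
    Sym   : Set
    arity : Sym → ℕ
open Language public

data Formula (L : Language) (n : ℕ) : Set where
  rel    : (s : Sym L) → Vec (Fin n) (arity L s) → Formula L n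
  equ    : Fin n → Fin n → Formula L n
  falsum : Formula L n
  neg    : Formula L n → Formula L n
  and    : Formula L n → Formula L n → Formula L n
  or     : Formula L n → Formula L n → Formula L n
  imp    : Formula L n → Formula L n → Formula L n
  all    : Formula (L) (Data.Nat.suc n) → Formula L n
  ex     : Formula (L) (Data.Nat.suc n) → Formula L n

addUnary : Language → Language
addUnary L = record { Sym = Sym L ⊎ ⊤ ; arity = [ arity L , (λ _ → 1) ] }

-- L together with j second-order parameters (fresh symbols) of arities ar
withPars : Language → {j : ℕ} → (Fin j → ℕ) → Language
withPars L ar = record { Sym = Sym L ⊎ Fin _ ; arity = [ arity L , ar ] }

-- A scheme in language L: a sentence of L ∪ {P}, P the marked unary predicate inj₂ tt
Scheme : Language → Set
Scheme L = Formula (addUnary L) 0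

rename : {L L' : Language} (f : Sym L → Sym L') →
         (∀ s → arity L' (f s) ≡ arity L s) → {n : ℕ} → Formula L n → Formula L' n
rename f p (rel s ts) = rel (f s) (subst (Vec (Fin _)) (sym (p s)) ts)
rename f p (equ x y)  = equ x y
rename f p falsum     = falsum
rename f p (neg φ)    = neg (rename f p φ)
rename f p (and φ ψ)  = and (rename f p φ) (rename f p ψ)
rename f p (or φ ψ)   = or (rename f p φ) (rename f p ψ)
rename f p (imp φ ψ)  = imp (rename f p φ) (rename f p ψ)
rename f p (all φ)    = all (rename f p φ)
rename f p (ex φ)     = ex (rename f p φ)

-- The scheme  σ(P) ∧ α[Q/P] ∧ μ_Q(α)(P)  of L_σ ∪ {Q}
-- Symbols of addUnary (addUnary Lσ):
--   inj₁ (inj₁ s) = s ∈ Lσ,  inj₁ (inj₂ tt) = Q (fresh),  inj₂ tt = P (marked)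

weakenQ : {L : Language} → Scheme L → Scheme (addUnary L)
weakenQ {L} = rename {addUnary L} {addUnary (addUnary L)}
  (λ { (inj₁ s) → inj₁ (inj₁ s) ; (inj₂ t) → inj₂ t })
  (λ { (inj₁ s) → refl ; (inj₂ t) → refl })

substQ : {L : Language} → Scheme L → Scheme (addUnary L)
substQ {L} = rename {addUnary L} {addUnary (addUnary L)}
  (λ { (inj₁ s) → inj₁ (inj₁ s) ; (inj₂ t) → inj₁ (inj₂ t) })
  (λ { (inj₁ s) → refl ; (inj₂ t) → refl })

muQ : {L : Language} → Scheme L → Scheme (addUnary L)
muQ α = imp (weakenQ α)
            (all (imp (rel (inj₁ (inj₂ tt)) (zero ∷ []))
                      (rel (inj₂ tt) (zero ∷ []))))

newScheme : {L : Language} → Scheme L → Scheme L → Scheme (addUnary L)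
newScheme σ α = and (weakenQ σ) (and (substQ α) (muQ α))

record Structure (L : Language) : Set₁ where
  field
    U   : Set
    Dom : U → Set
    Eq  : U → U → Set
    Rel : (s : Sym L) → Vec U (arity L s) → Set
open Structure public

Sat : {L : Language} (𝔄 : Structure L) {n : ℕ} → Formula L n → Vec (U 𝔄) n → Set
Sat 𝔄 (rel s ts) ρ = Rel 𝔄 s (Data.Vec.map (λ x → lookup ρ x) ts)
Sat 𝔄 (equ x y)  ρ = Eq 𝔄 (lookup ρ x) (lookup ρ y)
Sat 𝔄 falsum     ρ = ⊥
Sat 𝔄 (neg φ)    ρ = Sat 𝔄 φ ρ → ⊥
Sat 𝔄 (and φ ψ)  ρ = Sat 𝔄 φ ρ × Sat 𝔄 ψ ρ
Sat 𝔄 (or φ ψ)   ρ = Sat 𝔄 φ ρ ⊎ Sat 𝔄 ψ ρ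
Sat 𝔄 (imp φ ψ)  ρ = Sat 𝔄 φ ρ → Sat 𝔄 ψ ρ
Sat 𝔄 (all φ)    ρ = (u : U 𝔄) → Dom 𝔄 u → Sat 𝔄 φ (u ∷ ρ)
Sat 𝔄 (ex φ)     ρ = Σ (U 𝔄) (λ u → Dom 𝔄 u × Sat 𝔄 φ (u ∷ ρ))

-- Pairs (𝓜, 𝓧): an L₀-structure 𝓜 and a family 𝓧 of subsets of powers of M

record Model (L₀ : Language) : Set₁ where
  field
    M : Set
    I : (s : Sym L₀) → Vec M (arity L₀ s) → Set
    X : (n : ℕ) → (Vec M n → Set) → Set
open Model public

XSet : {L₀ : Language} → Model L₀ → ℕ → Set₁
XSet 𝓜 n = Σ (Vec (M 𝓜) n → Set) (X 𝓜 n)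

ambient : {L₀ : Language} (𝓜 : Model L₀) {j : ℕ} (ar : Fin j → ℕ) →
          ((i : Fin j) → XSet 𝓜 (ar i)) → Structure (withPars L₀ ar)
ambient 𝓜 ar As = record
  { U = M 𝓜 ; Dom = λ _ → ⊤ ; Eq = _≡_
  ; Rel = λ { (inj₁ s) → I 𝓜 s ; (inj₂ i) → proj₁ (As i) } }

ambientP : {L₀ : Language} (𝓜 : Model L₀) → XSet 𝓜 1 → Structure (addUnary L₀)
ambientP 𝓜 A = record
  { U = M 𝓜 ; Dom = λ _ → ⊤ ; Eq = _≡_
  ; Rel = λ { (inj₁ s) → I 𝓜 s ; (inj₂ _) → proj₁ A } }

-- comprehension with first- and second-order parameters (PC)
Comprehension : {L₀ : Language} → Model L₀ → Set₁
Comprehension {L₀} 𝓜 =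
  {j : ℕ} (ar : Fin j → ℕ) (As : (i : Fin j) → XSet 𝓜 (ar i))
  (n m : ℕ) (φ : Formula (withPars L₀ ar) (n + m)) (p : Vec (M 𝓜) m) →
  X 𝓜 n (λ v → Sat (ambient 𝓜 ar As) φ (v ++ p))

-- comprehension without first-order parameters (sPC)
sComprehension : {L₀ : Language} → Model L₀ → Set₁
sComprehension {L₀} 𝓜 =
  {j : ℕ} (ar : Fin j → ℕ) (As : (i : Fin j) → XSet 𝓜 (ar i))
  (n : ℕ) (φ : Formula (withPars L₀ ar) n) →
  X 𝓜 n (λ v → Sat (ambient 𝓜 ar As) φ v)

SatisfiesS : {L₀ : Language} → (Scheme L₀ → Set) → Model L₀ → Set₁
SatisfiesS S 𝓜 = (φ : Scheme _) → S φ → (A : XSet 𝓜 1) → Sat (ambientP 𝓜 A) φ []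

ModelOfPC : (standalone : Bool) {L₀ : Language} → (Scheme L₀ → Set) → Model L₀ → Set₁
ModelOfPC false S 𝓜 = Comprehension 𝓜 × SatisfiesS S 𝓜
ModelOfPC true  S 𝓜 = sComprehension 𝓜 × SatisfiesS S 𝓜

-- 𝓧-strong structures: domain ⊆ M^k, equality ⊆ M^(k+k), relations ⊆ M^(ar·k), all in 𝓧

record XStructure {L₀ : Language} (𝓜 : Model L₀) (L : Language) : Set₁ where
  field
    k    : ℕ
    D    : Vec (M 𝓜) k → Set
    D∈X  : X 𝓜 k D
    E    : Vec (M 𝓜) (k + k) → Set
    E∈X  : X 𝓜 (k + k) E
    R    : (s : Sym L) → Vec (M 𝓜) (arity L s * k) → Set
    R∈X  : (s : Sym L) → X 𝓜 (arity L s * k) (R s)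
    E-refl  : ∀ u → D u → E (u ++ u)
    E-sym   : ∀ u v → D u → D v → E (u ++ v) → E (v ++ u)
    E-trans : ∀ u v w → D u → D v → D w → E (u ++ v) → E (v ++ w) → E (u ++ w)
    R-cong  : (s : Sym L) (us vs : Vec (Vec (M 𝓜) k) (arity L s)) →
              All D us → All D vs → Pointwise (λ u v → E (u ++ v)) us vs →
              R s (concat us) → R s (concat vs)
open XStructure public

withP : {L₀ : Language} {𝓜 : Model L₀} {L : Language} (N : XStructure 𝓜 L) →
        (Vec (M 𝓜) (k N) → Set) → Structure (addUnary L)
withP N A = record
  { U = Vec _ (k N) ; Dom = D N ; Eq = λ u v → E N (u ++ v)
  ; Rel = λ { (inj₁ s) us → R N s (concat us) ; (inj₂ _) us → A (head us) } }

XStrongModel : {L₀ : Language} {𝓜 : Model L₀} {L : Language} →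
               Scheme L → XStructure 𝓜 L → Set₁
XStrongModel {𝓜 = 𝓜} σ N =
  (A : Vec (M 𝓜) (k N) → Set) → X 𝓜 (k N) A → Sat (withP N A) σ []

-- an isomorphism between N₁ and N₂ lying in 𝓧 (given by its graph F ⊆ M^(k₁+k₂))
record XIso {L₀ : Language} {𝓜 : Model L₀} {L : Language}
            (N₁ N₂ : XStructure 𝓜 L) : Set₁ where
  field
    F    : Vec (M 𝓜) (k N₁ + k N₂) → Set
    F∈X  : X 𝓜 (k N₁ + k N₂) F
    F-dom : ∀ u v → F (u ++ v) → D N₁ u × D N₂ v
    F-tot : ∀ u → D N₁ u → Σ (Vec (M 𝓜) (k N₂)) (λ v → D N₂ v × F (u ++ v))
    F-sur : ∀ v → D N₂ v → Σ (Vec (M 𝓜) (k N₁)) (λ u → D N₁ u × F (u ++ v))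
    F-eq  : (u u' : Vec (M 𝓜) (k N₁)) (v v' : Vec (M 𝓜) (k N₂)) → F (u ++ v) → F (u' ++ v') →
            E N₁ (u ++ u') ⇔ E N₂ (v ++ v')
    F-rel : (s : Sym L) (us : Vec (Vec (M 𝓜) (k N₁)) (arity L s))
            (vs : Vec (Vec (M 𝓜) (k N₂)) (arity L s)) →
            Pointwise (λ u v → F (u ++ v)) us vs →
            R N₁ s (concat us) ⇔ R N₂ s (concat vs)

Categorical : (standalone : Bool) {L₀ : Language} → (Scheme L₀ → Set) →
              {L : Language} → Scheme L → Set₁
Categorical b {L₀} S {L} σ =
  (𝓜 : Model L₀) → ModelOfPC b S 𝓜 →
  (N₁ N₂ : XStructure 𝓜 L) → XStrongModel σ N₁ → XStrongModel σ N₂ → XIso N₁ N₂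

{-# OPTIONS --safe #-}
module Submission where

-- Let N₁, N₂ be 𝓧-strong models of σ(P) ∧ α[Q/P] ∧ μ_Q(α)(P). Their Lσ-reducts are
-- 𝓧-strong models of σ, so categoricity gives an isomorphism F ∈ 𝓧 between them, and it
-- only remains to see that F carries Q₁ onto Q₂. The preimage A = F⁻¹[Q₂] lies in 𝓧 by
-- comprehension with the parameters Q₂ and F alone (so sPC suffices). Transporting along
-- F, (N₁, A) ≅ (N₂, Q₂) ⊨ α, so the minimality clause μ_Q(α) of N₁ applied to A gives
-- Q₁ ⊆ A, that is F[Q₁] ⊆ Q₂. The reverse inclusion is the same argument for F⁻¹, using
-- the image F[Q₁] ∈ 𝓧.

open import Defs
open import Data.Bool using (Bool; true; false)
open import Data.Nat using (ℕ; zero; suc; _+_)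
open import Data.Fin using (Fin; zero; suc; _↑ˡ_; _↑ʳ_)
open import Data.Product using (∃-syntax; _×_; _,_; proj₁; proj₂)
open import Data.Product.Function.Dependent.Propositional using (Σ-⇔)
open import Data.Product.Function.NonDependent.Propositional using (_×-⇔_)
open import Data.Sum using (inj₁; inj₂)
open import Data.Sum.Function.Propositional using (_⊎-⇔_)
open import Data.Unit using (tt)
open import Data.Vec using (Vec; []; _∷_; lookup; _++_; concat; map; tabulate; allFin)
open import Data.Vec.Properties
  using (map-++; map-∘; map-cong; lookup-++ˡ; lookup-++ʳ; map-lookup-allFin;
         tabulate∘lookup; tabulate-∘; tabulate-cong)
import Data.Vec.Relation.Binary.Pointwise.Inductive as Pointwise
open Pointwise using (Pointwise; []; _∷_; Pointwise-≡⇒≡)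
open import Data.Vec.Relation.Unary.All using ([]; _∷_)
open import Function using (id; flip; _∘_)
open import Function.Bundles using (_⇔_; mk⇔; Equivalence)
open import Function.Construct.Composition using (_⇔-∘_)
open import Function.Construct.Identity using (⇔-id; ↠-id)
open import Function.Construct.Symmetry using (⇔-sym)
open import Function.Related.TypeIsomorphisms using (→-cong-⇔; ¬-cong-⇔)
open import Relation.Binary.PropositionalEquality using (_≡_; refl; sym; trans; subst; cong; cong₂)
open Equivalence using (to; from)

restrict : {L L' : Language} (f : Sym L → Sym L') → (∀ s → arity L' (f s) ≡ arity L s) →
           Structure L' → Structure L
restrict f p 𝔄 = record
  { U = U 𝔄 ; Dom = Dom 𝔄 ; Eq = Eq 𝔄
  ; Rel = λ s xs → Rel 𝔄 (f s) (subst (Vec (U 𝔄)) (sym (p s)) xs) }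

record Correspondence {L : Language} (𝔄 𝔅 : Structure L) : Set₁ where
  field
    _∼_        : U 𝔄 → U 𝔅 → Set
    domains    : ∀ {a b} → a ∼ b → Dom 𝔄 a × Dom 𝔅 b
    total      : ∀ a → Dom 𝔄 a → ∃[ b ] Dom 𝔅 b × a ∼ b
    surjective : ∀ b → Dom 𝔅 b → ∃[ a ] Dom 𝔄 a × a ∼ b
    Eq-resp    : ∀ {a a' b b'} → a ∼ b → a' ∼ b' → Eq 𝔄 a a' ⇔ Eq 𝔅 b b'
    Rel-resp   : ∀ s {as bs} → Pointwise _∼_ as bs → Rel 𝔄 s as ⇔ Rel 𝔅 s bs

  converse : Correspondence 𝔅 𝔄
  converse = record
    { _∼_        = flip _∼_
    ; domains    = λ b∼a → let (da , db) = domains b∼a in db , da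
    ; total      = surjective
    ; surjective = total
    ; Eq-resp    = λ a∼b a'∼b' → ⇔-sym (Eq-resp a∼b a'∼b')
    ; Rel-resp   = λ s bs∼as → ⇔-sym (Rel-resp s (Pointwise.sym id bs∼as))
    }

map-subst : {A B : Set} (g : A → B) {m n : ℕ} (m≡n : m ≡ n) (xs : Vec A m) →
            map g (subst (Vec A) m≡n xs) ≡ subst (Vec B) m≡n (map g xs)
map-subst g refl xs = refl

module _ {L L' : Language} {f : Sym L → Sym L'} {p : ∀ s → arity L' (f s) ≡ arity L s}
         {𝔄 : Structure L'} {𝔅 : Structure L} (C : Correspondence (restrict f p 𝔄) 𝔅) where
  open Correspondence C

  Sat-rename : ∀ {n} (φ : Formula L n) {ρ σ} → Pointwise _∼_ ρ σ →
               Sat 𝔄 (rename f p φ) ρ ⇔ Sat 𝔅 φ σ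
  Sat-rename (rel s ts) {ρ} {σ} ρ∼σ =
    subst (λ xs → Rel 𝔄 (f s) xs ⇔ Rel 𝔅 s (map (lookup σ) ts))
          (sym (map-subst (lookup ρ) (sym (p s)) ts))
          (Rel-resp s (lookup-resp ts))
    where
    lookup-resp : ∀ {r} (ts : Vec (Fin _) r) → Pointwise _∼_ (map (lookup ρ) ts) (map (lookup σ) ts)
    lookup-resp []       = []
    lookup-resp (t ∷ ts) = Pointwise.lookup ρ∼σ t ∷ lookup-resp ts
  Sat-rename (equ x y)  ρ∼σ = Eq-resp (Pointwise.lookup ρ∼σ x) (Pointwise.lookup ρ∼σ y)
  Sat-rename falsum     ρ∼σ = ⇔-id _
  Sat-rename (neg φ)    ρ∼σ = ¬-cong-⇔ (Sat-rename φ ρ∼σ)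
  Sat-rename (and φ ψ)  ρ∼σ = Sat-rename φ ρ∼σ ×-⇔ Sat-rename ψ ρ∼σ
  Sat-rename (or φ ψ)   ρ∼σ = Sat-rename φ ρ∼σ ⊎-⇔ Sat-rename ψ ρ∼σ
  Sat-rename (imp φ ψ)  ρ∼σ = →-cong-⇔ (Sat-rename φ ρ∼σ) (Sat-rename ψ ρ∼σ)
  Sat-rename (all φ)    ρ∼σ = mk⇔
    (λ h b db → let (a , da , a∼b) = surjective b db in to (Sat-rename φ (a∼b ∷ ρ∼σ)) (h a da))
    (λ h a da → let (b , db , a∼b) = total a da in from (Sat-rename φ (a∼b ∷ ρ∼σ)) (h b db))
  Sat-rename (ex φ)     ρ∼σ = mk⇔
    (λ (a , da , sa) → let (b , db , a∼b) = total a da in b , db , to (Sat-rename φ (a∼b ∷ ρ∼σ)) sa)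
    (λ (b , db , sb) → let (a , da , a∼b) = surjective b db in a , da , from (Sat-rename φ (a∼b ∷ ρ∼σ)) sb)

subst-⇔ : {A : Set} (P : A → Set) {x y : A} → x ≡ y → P x ⇔ P y
subst-⇔ P refl = ⇔-id _

≡-Correspondence : {L : Language} (𝔄 : Structure L)
                   {RB : (s : Sym L) → Vec (U 𝔄) (arity L s) → Set} →
                   (∀ s xs → Rel 𝔄 s xs ⇔ RB s xs) →
                   Correspondence 𝔄 (record { U = U 𝔄 ; Dom = Dom 𝔄 ; Eq = Eq 𝔄 ; Rel = RB })
≡-Correspondence 𝔄 {RB} Rel⇔RB = record
  { _∼_        = λ a b → Dom 𝔄 a × a ≡ b
  ; domains    = λ { (da , refl) → da , da }
  ; total      = λ a da → a , da , da , refl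
  ; surjective = λ a da → a , da , da , refl
  ; Eq-resp    = λ { (_ , refl) (_ , refl) → ⇔-id _ }
  ; Rel-resp   = λ s as∼bs →
      subst-⇔ (RB s) (Pointwise-≡⇒≡ (Pointwise.map proj₂ as∼bs)) ⇔-∘ Rel⇔RB s _
  }

exBlock : {L : Language} {n : ℕ} (m : ℕ) → Formula L (m + n) → Formula L n
exBlock zero    φ = φ
exBlock (suc m) φ = exBlock m (ex φ)

Sat-exBlock : {L : Language} (𝔄 : Structure L) → (∀ a → Dom 𝔄 a) → ∀ {n} (m : ℕ)
              (φ : Formula L (m + n)) (ρ : Vec (U 𝔄) n) →
              Sat 𝔄 (exBlock m φ) ρ ⇔ (∃[ w ] Sat 𝔄 φ (w ++ ρ))
Sat-exBlock 𝔄 everywhere zero    φ ρ = mk⇔ ([] ,_) λ { ([] , sat) → sat }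
Sat-exBlock 𝔄 everywhere (suc m) φ ρ = mk⇔
  (λ sat → let (w , a , _ , sat′) = to IH sat in a ∷ w , sat′)
  (λ { (a ∷ w , sat) → from IH (w , a , everywhere a , sat) })
  where IH = Sat-exBlock 𝔄 everywhere m (ex φ) ρ

-- Membership in 𝓧 is not extensional, so comprehension only yields a member of 𝓧
-- pointwise equivalent to the intended set.
Definable : {L₀ : Language} (𝓜 : Model L₀) (n : ℕ) → (Vec (M 𝓜) n → Set) → Set₁
Definable 𝓜 n B = ∃[ B′ ] X 𝓜 n B′ × (∀ v → B′ v ⇔ B v)

map-lookup-++-↑ˡ : {A : Set} {m c : ℕ} (w : Vec A m) (e : Vec A c) →
                   map (lookup (w ++ e)) (tabulate (_↑ˡ c)) ≡ w
map-lookup-++-↑ˡ w e =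
  trans (sym (tabulate-∘ _ _)) (trans (tabulate-cong (lookup-++ˡ w e)) (tabulate∘lookup w))

map-lookup-++-↑ʳ : {A : Set} {m c r : ℕ} (w : Vec A m) (e : Vec A c) (xs : Vec (Fin c) r) →
                   map (lookup (w ++ e)) (map (m ↑ʳ_) xs) ≡ map (lookup e) xs
map-lookup-++-↑ʳ w e xs = trans (sym (map-∘ _ _ xs)) (map-cong (lookup-++ʳ w e) xs)

-- The defining formula is given for every placement xs of the defined tuple among the
-- variables: sPC needs the tuple to be the whole context, PC (with no first-order
-- parameters) needs it to be the front of a context of length n + 0.
comprehension : {b : Bool} {L₀ : Language} {S : Scheme L₀ → Set} {𝓜 : Model L₀} →
  ModelOfPC b S 𝓜 →
  ∀ {j} (ar : Fin j → ℕ) (As : (i : Fin j) → XSet 𝓜 (ar i)) {n} (B : Vec (M 𝓜) n → Set)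
  (φ : ∀ {c} → Vec (Fin c) n → Formula (withPars L₀ ar) c) →
  (∀ {c} (xs : Vec (Fin c) n) e → Sat (ambient 𝓜 ar As) (φ xs) e ⇔ B (map (lookup e) xs)) →
  Definable 𝓜 n B
comprehension {true} (sPC , _) ar As {n} B φ φ⇔B =
  _ , sPC ar As n (φ (allFin n)) ,
  λ v → subst-⇔ B (map-lookup-allFin v) ⇔-∘ φ⇔B (allFin n) v
comprehension {false} (PC , _) ar As {n} B φ φ⇔B =
  _ , PC ar As n 0 (φ front) [] ,
  λ v → subst-⇔ B (map-lookup-++-↑ˡ v []) ⇔-∘ φ⇔B front (v ++ [])
  where front = tabulate (_↑ˡ 0)

-- P is coded like the marked predicate of an 𝓧-structure on m-tuples: a subset of
-- M^(1·m) = M^(m+0), applied to w ++ [].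
∃-definable : {b : Bool} {L₀ : Language} {S : Scheme L₀ → Set} {𝓜 : Model L₀} →
  ModelOfPC b S 𝓜 →
  ∀ {m n r} (P : XSet 𝓜 (m + 0)) (F : XSet 𝓜 r)
  (arrange : ∀ {Y : Set} → Vec Y m → Vec Y n → Vec Y r) →
  (∀ {Y Z : Set} (g : Y → Z) w x → map g (arrange w x) ≡ arrange (map g w) (map g x)) →
  Definable 𝓜 n (λ x → ∃[ w ] proj₁ P (w ++ []) × proj₁ F (arrange w x))
∃-definable {𝓜 = 𝓜} 𝓜⊨PC {m} (P , P∈X) (F , F∈X) arrange arrange-natural =
  comprehension 𝓜⊨PC ar As _ φ φ⇔
  where
  ar : Fin 2 → ℕ
  ar = lookup (m + 0 ∷ _ ∷ [])
  As : (i : Fin 2) → XSet 𝓜 (ar i)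
  As zero       = P , P∈X
  As (suc zero) = F , F∈X
  φ : ∀ {c} → Vec (Fin c) _ → Formula (withPars _ ar) c
  φ {c} xs = exBlock m (and (rel (inj₂ zero) (bound ++ []))
                            (rel (inj₂ (suc zero)) (arrange bound (map (m ↑ʳ_) xs))))
    where bound = tabulate (_↑ˡ c)
  φ⇔ : ∀ {c} (xs : Vec (Fin c) _) e →
       Sat (ambient 𝓜 ar As) (φ xs) e ⇔ (∃[ w ] P (w ++ []) × F (arrange w (map (lookup e) xs)))
  φ⇔ {c} xs e = Σ-⇔ (↠-id _) (λ {w} → subst-⇔ P (P-args w) ×-⇔ subst-⇔ F (F-args w))
                ⇔-∘ Sat-exBlock (ambient 𝓜 ar As) (λ _ → tt) m _ e
    where
    bound = tabulate (_↑ˡ c)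
    P-args : ∀ w → map (lookup (w ++ e)) (bound ++ []) ≡ w ++ []
    P-args w = trans (map-++ _ bound []) (cong (_++ []) (map-lookup-++-↑ˡ w e))
    F-args : ∀ w → map (lookup (w ++ e)) (arrange bound (map (m ↑ʳ_) xs))
                   ≡ arrange w (map (lookup e) xs)
    F-args w = trans (arrange-natural _ bound _)
                     (cong₂ arrange (map-lookup-++-↑ˡ w e) (map-lookup-++-↑ʳ w e xs))

module _ {L₀ : Language} {𝓜 : Model L₀} where

  structure : {L : Language} → XStructure 𝓜 L → Structure L
  structure N = record
    { U = Vec (M 𝓜) (k N) ; Dom = D N ; Eq = λ u v → E N (u ++ v)
    ; Rel = λ s us → R N s (concat us) }

  XIso⇒Correspondence : {L : Language} {N₁ N₂ : XStructure 𝓜 L} → XIso N₁ N₂ →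
                        Correspondence (structure N₁) (structure N₂)
  XIso⇒Correspondence iso = record
    { _∼_        = λ u v → F (u ++ v)
    ; domains    = F-dom _ _
    ; total      = F-tot
    ; surjective = F-sur
    ; Eq-resp    = λ {a} {a'} {b} {b'} → F-eq a a' b b'
    ; Rel-resp   = λ s → F-rel s _ _
    }
    where open XIso iso

  module _ {Lσ : Language} where

    reduct : XStructure 𝓜 (addUnary Lσ) → XStructure 𝓜 Lσ
    reduct N = record
      { k = k N ; D = D N ; D∈X = D∈X N ; E = E N ; E∈X = E∈X N
      ; R = R N ∘ inj₁ ; R∈X = R∈X N ∘ inj₁
      ; E-refl = E-refl N ; E-sym = E-sym N ; E-trans = E-trans N
      ; R-cong = R-cong N ∘ inj₁ }

    Q : (N : XStructure 𝓜 (addUnary Lσ)) → Vec (M 𝓜) (k N) → Set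
    Q N u = R N (inj₂ tt) (u ++ [])

    Q-resp-E : (N : XStructure 𝓜 (addUnary Lσ)) →
               ∀ {u v} → D N u → D N v → E N (u ++ v) → Q N u → Q N v
    Q-resp-E N du dv uEv = R-cong N (inj₂ tt) (_ ∷ []) (_ ∷ []) (du ∷ []) (dv ∷ []) (uEv ∷ [])

    extend-XIso : {N₁ N₂ : XStructure 𝓜 (addUnary Lσ)} (iso : XIso (reduct N₁) (reduct N₂)) →
                  (∀ u v → XIso.F iso (u ++ v) → Q N₁ u ⇔ Q N₂ v) → XIso N₁ N₂
    extend-XIso iso Q-resp = record
      { F = F ; F∈X = F∈X ; F-dom = F-dom ; F-tot = F-tot ; F-sur = F-sur ; F-eq = F-eq
      ; F-rel = λ { (inj₁ s) → F-rel s
                  ; (inj₂ tt) (u ∷ []) (v ∷ []) (uFv ∷ []) → Q-resp u v uFv } }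
      where open XIso iso

    Sat-weakenQ : (N : XStructure 𝓜 (addUnary Lσ)) (A : Vec (M 𝓜) (k N) → Set) (φ : Scheme Lσ) →
                  Sat (withP N A) (weakenQ φ) [] ⇔ Sat (withP (reduct N) A) φ []
    Sat-weakenQ N A φ =
      Sat-rename (≡-Correspondence _ λ { (inj₁ s) xs → ⇔-id _ ; (inj₂ tt) xs → ⇔-id _ }) φ []

    Sat-substQ : (N' : XStructure 𝓜 (addUnary Lσ)) (B : Vec (M 𝓜) (k N') → Set)
                 {N : XStructure 𝓜 Lσ} {A : Vec (M 𝓜) (k N) → Set}
                 (C : Correspondence (structure (reduct N')) (structure N)) →
                 (∀ {v u} → Correspondence._∼_ C v u → Q N' v ⇔ A u) →
                 (φ : Scheme Lσ) → Sat (withP N' B) (substQ φ) [] ⇔ Sat (withP N A) φ []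
    Sat-substQ N' B C Q⇔A φ = Sat-rename (record
      { _∼_ = _∼_ ; domains = domains ; total = total ; surjective = surjective ; Eq-resp = Eq-resp
      ; Rel-resp = λ { (inj₁ s) → Rel-resp s ; (inj₂ tt) (v∼u ∷ []) → Q⇔A v∼u } }) φ []
      where open Correspondence C

    module NewScheme (σ α : Scheme Lσ) where

      strong-reduct : {N : XStructure 𝓜 (addUnary Lσ)} →
                      XStrongModel (newScheme σ α) N → XStrongModel σ (reduct N)
      strong-reduct {N} N⊨ A A∈X = to (Sat-weakenQ N A σ) (proj₁ (N⊨ A A∈X))

      Q-least : {N : XStructure 𝓜 (addUnary Lσ)} → XStrongModel (newScheme σ α) N →
                ∀ {A} → X 𝓜 (k N) A → Sat (withP (reduct N) A) α [] → ∀ u → D N u → Q N u → A u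
      Q-least {N} N⊨ {A} A∈X αA = proj₂ (proj₂ (N⊨ A A∈X)) (from (Sat-weakenQ N A α) αA)

      Q-preserved : {N N' : XStructure 𝓜 (addUnary Lσ)} →
        XStrongModel (newScheme σ α) N → XStrongModel (newScheme σ α) N' →
        (C : Correspondence (structure (reduct N)) (structure (reduct N'))) →
        let open Correspondence C in
        Definable 𝓜 (k N) (λ u → ∃[ v ] Q N' v × u ∼ v) →
        ∀ {u v} → u ∼ v → Q N u → Q N' v
      Q-preserved {N} {N'} N⊨ N'⊨ C (A , A∈X , A⇔) {u} u∼v Qu =
        let (v' , Qv' , u∼v') = to (A⇔ u) (Q-least N⊨ A∈X α-at-A u (proj₁ (domains u∼v)) Qu)
        in Q-along u∼v' u∼v Qv'
        where
        open Correspondence C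

        Q-along : ∀ {u v v'} → u ∼ v → u ∼ v' → Q N' v → Q N' v'
        Q-along u∼v u∼v' = Q-resp-E N' (proj₂ (domains u∼v)) (proj₂ (domains u∼v'))
          (to (Eq-resp u∼v u∼v') (E-refl N _ (proj₁ (domains u∼v))))

        Q-corresponds-to-A : ∀ {v u} → u ∼ v → Q N' v ⇔ A u
        Q-corresponds-to-A {v} {u} u∼v = mk⇔
          (λ Qv → from (A⇔ u) (v , Qv , u∼v))
          (λ Au → let (v' , Qv' , u∼v') = to (A⇔ u) Au in Q-along u∼v' u∼v Qv')

        α-at-A : Sat (withP (reduct N) A) α []
        α-at-A = to (Sat-substQ N' (D N') converse Q-corresponds-to-A α)
                    (proj₁ (proj₂ (N'⊨ (D N') (D∈X N'))))

mainTheorem9 : (standalone : Bool) (L₀ Lσ : Language) (S : Scheme L₀ → Set)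
    (σ α : Scheme Lσ) →
    Categorical standalone S σ →
    Categorical standalone S (newScheme σ α)
mainTheorem9 _ _ _ _ σ α σ-categorical 𝓜 𝓜⊨PC N₁ N₂ N₁⊨ N₂⊨ =
  extend-XIso iso λ u v uFv →
    mk⇔ (Q-preserved N₁⊨ N₂⊨ C preimage-of-Q₂ uFv)
        (Q-preserved N₂⊨ N₁⊨ (Correspondence.converse C) image-of-Q₁ uFv)
  where
  open NewScheme {𝓜 = 𝓜} σ α

  iso : XIso (reduct N₁) (reduct N₂)
  iso = σ-categorical 𝓜 𝓜⊨PC (reduct N₁) (reduct N₂) (strong-reduct N₁⊨) (strong-reduct N₂⊨)
  open XIso iso using (F; F∈X)

  C : Correspondence (structure (reduct N₁)) (structure (reduct N₂))
  C = XIso⇒Correspondence iso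

  preimage-of-Q₂ : Definable 𝓜 (k N₁) (λ u → ∃[ v ] Q N₂ v × F (u ++ v))
  preimage-of-Q₂ = ∃-definable 𝓜⊨PC (R N₂ (inj₂ tt) , R∈X N₂ (inj₂ tt)) (F , F∈X)
                               (flip _++_) (λ g w x → map-++ g x w)

  image-of-Q₁ : Definable 𝓜 (k N₂) (λ v → ∃[ u ] Q N₁ u × F (u ++ v))
  image-of-Q₁ = ∃-definable 𝓜⊨PC (R N₁ (inj₂ tt) , R∈X N₁ (inj₂ tt)) (F , F∈X) _++_ map-++
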